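{- Let $G$ be a graph with no universal vertices or true twins and let $G'$ be a circular completion of $G$. Then: (1) $G'$ has no universal vertices or true twins; (2) at least one vertex of every circular pair of $G'$ belongs to $V(G)$; (3) $|V(G')|\ge 2|V(G)|-|S|$, where $S$ is the set of vertices of $G$ that belong to some circular pair of $G$.
   Context: Graphs are finite with a loop at every vertex; $N[u]$ is the closed neighbourhood. Universal vertex: $N[u]=V$; true twins: $N[u]=N[v]$. Edge types in a graph: $uv$ is an inclusion edge if $N[u],N[v]$ are comparable under inclusion, otherwise an overlap edge; $\{u,v\}$ is a spanning pair if every $x\notin N[v]$ has $N[x]\subseteq N[u]$ and every $y\notin N[u]$ has $N[y]\subseteq N[v]$; an overlap edge is a 2-overlap edge if its endpoints form a spanning pair, and a 1-overlap edge otherwise. $\{u,v\}$ is a circular pair if it is a spanning pair and $uv\notin E$. A graph is circularly-paired if every vertex belongs to some circular pair. A circular completion of $G$ is a circularly-paired graph $H$ with the minimum number of vertices among graphs such that (i) $H$ contains $G$ as an induced subgraph, and (ii) every edge of $G$ has the same type (inclusion, 1-overlap, 2-overlap) in $G$ and in $H$. -}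

module Defs where

open import Data.Nat using (ℕ)
open import Data.Bool using (Bool; true; false)
open import Data.Fin using (Fin)
open import Data.Fin.Subset using (Subset; _∈_; ∣_∣)
open import Data.Product using (Σ; ∃; _×_; _,_)
open import Data.Sum using (_⊎_)
open import Relation.Nullary using (¬_)
open import Relation.Binary.PropositionalEquality using (_≡_; _≢_)
open import Function.Bundles using (_⇔_)

record Graph : Set where
  field
    n     : ℕ
    E     : Fin n → Fin n → Bool
    loops : ∀ u → E u u ≡ true
    symm  : ∀ u v → E u v ≡ E v u
open Graph public

V : Graph → Set
V G = Fin (n G)

-- adjacency (uv ∈ E, equivalently v ∈ N[u])
Adj : (G : Graph) → V G → V G → Set
Adj G u v = E G u v ≡ true

NSub : (G : Graph) → V G → V G → Set
NSub G u v = ∀ x → Adj G u x → Adj G v x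

Universal : (G : Graph) → V G → Set
Universal G u = ∀ x → Adj G u x

TrueTwins : (G : Graph) → V G → V G → Set
TrueTwins G u v = u ≢ v × NSub G u v × NSub G v u

NoUnivNoTwins : Graph → Set
NoUnivNoTwins G = (∀ u → ¬ Universal G u) × (∀ u v → ¬ TrueTwins G u v)

InclusionEdge : (G : Graph) → V G → V G → Set
InclusionEdge G u v = Adj G u v × (NSub G u v ⊎ NSub G v u)

SpanningPair : (G : Graph) → V G → V G → Set
SpanningPair G u v =
  (∀ x → ¬ Adj G v x → NSub G x u) × (∀ y → ¬ Adj G u y → NSub G y v)

OverlapEdge : (G : Graph) → V G → V G → Set
OverlapEdge G u v = Adj G u v × ¬ (NSub G u v ⊎ NSub G v u)

TwoOverlapEdge : (G : Graph) → V G → V G → Set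
TwoOverlapEdge G u v = OverlapEdge G u v × SpanningPair G u v

OneOverlapEdge : (G : Graph) → V G → V G → Set
OneOverlapEdge G u v = OverlapEdge G u v × ¬ SpanningPair G u v

CircularPair : (G : Graph) → V G → V G → Set
CircularPair G u v = SpanningPair G u v × ¬ Adj G u v

InCircularPair : (G : Graph) → V G → Set
InCircularPair G u = ∃ λ v → CircularPair G u v

CircularlyPaired : Graph → Set
CircularlyPaired G = ∀ u → InCircularPair G u

record InducedEmb (G H : Graph) : Set where
  field
    f     : V G → V H
    inj   : ∀ u v → f u ≡ f v → u ≡ v
    adjEq : ∀ u v → E H (f u) (f v) ≡ E G u v
open InducedEmb public

PreservesTypes : (G H : Graph) → InducedEmb G H → Set
PreservesTypes G H φ = ∀ u v → Adj G u v →
    (InclusionEdge G u v ⇔ InclusionEdge H (f φ u) (f φ v))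
  × (OneOverlapEdge G u v ⇔ OneOverlapEdge H (f φ u) (f φ v))
  × (TwoOverlapEdge G u v ⇔ TwoOverlapEdge H (f φ u) (f φ v))

IsCandidate : (G H : Graph) → InducedEmb G H → Set
IsCandidate G H φ = CircularlyPaired H × PreservesTypes G H φ

IsCircularCompletion : (G H : Graph) → InducedEmb G H → Set
IsCircularCompletion G H φ =
  IsCandidate G H φ ×
  (∀ (H' : Graph) (ψ : InducedEmb G H') → IsCandidate G H' ψ → n H Data.Nat.≤ n H')

InImage : (G H : Graph) → InducedEmb G H → V H → Set
InImage G H φ w = ∃ λ u → f φ u ≡ w

-- A circular completion H of G admits no deletion of a nonempty set D of
-- vertices that avoids the image of G and leaves every remaining vertex a
-- remaining circular partner: the subgraph induced on the rest is again
-- circularly-paired and gives every edge of G the same type as H does, because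
-- neighbourhood inclusions in H are already witnessed on any vertex set closed
-- under circular partners.  A true twin outside the image, or a circular pair
-- outside the image of a twin-free H, would be such a D.  For (3), the vertices
-- of G and the circular partners of the vertices of G outside S are pairwise
-- distinct vertices of H, since circular partners are unique in a twin-free
-- graph and circular pairs of H between vertices of G are circular pairs of G.
module Submission where

open import Defs
open import Data.Nat using (ℕ; _+_; _*_; _≤_)
open import Data.Fin.Subset using (Subset; _∈_; ∣_∣)
open import Data.Product using (_×_)
open import Data.Sum using (_⊎_)
open import Function.Bundles using (_⇔_)

open import Function.Bundles using (mk⇔; Equivalence)
open import Data.Bool using (true)
import Data.Bool as Bool
open import Data.Nat using (suc; _<_)
open import Data.Nat.Properties
  using (+-suc; +-assoc; +-identityʳ; +-monoˡ-≤; m<m+n; ≤⇒≯; module ≤-Reasoning)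
open import Data.Fin using (Fin; zero; suc; splitAt; join; _≟_)
open import Data.Fin.Properties using (any?; injective⇒≤; join-splitAt; suc-injective)
open import Data.Fin.Subset using (_∉_; _∪_; ⁅_⁆; inside; outside)
open import Data.Fin.Subset.Properties
  using (x∈⁅x⁆; x∈⁅y⁆⇒x≡y; x≢y⇒x∉⁅y⁆; ∣⁅x⁆∣≡1; p⊆q⇒∣p∣≤∣q∣; x∈p∪q⁺; x∈p∪q⁻; drop-not-there)
open import Data.Vec.Base using (_∷_; []; here; there)
open import Data.Product using (Σ; ∃; _,_; proj₁; proj₂; map)
open import Data.Product.Function.NonDependent.Propositional using (_×-⇔_)
open import Data.Sum using (inj₁; inj₂; [_,_]′)
import Data.Sum as Sum
open import Data.Sum.Function.Propositional using (_⊎-⇔_)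
open import Data.Empty using (⊥; ⊥-elim)
open import Relation.Nullary using (¬_; Dec; yes; no; contradiction)
open import Relation.Binary.PropositionalEquality
  using (_≡_; _≢_; refl; sym; trans; cong; cong₂; subst; subst₂)
open import Function using (_∘_)
open import Function.Related.TypeIsomorphisms using (¬-cong-⇔)
open import Function.Construct.Identity using (⇔-id)
import Function.Properties.Equivalence as ⇔

Adj? : (G : Graph) (u v : V G) → Dec (Adj G u v)
Adj? G u v = E G u v Bool.≟ true

Adj-sym : (G : Graph) {u v : V G} → Adj G u v → Adj G v u
Adj-sym G {u} {v} = trans (symm G v u)

NSub-trans : (G : Graph) {a b c : V G} → NSub G a b → NSub G b c → NSub G a c
NSub-trans G a⊆b b⊆c x = b⊆c x ∘ a⊆b x

TwinFree : Graph → Set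
TwinFree G = ∀ u v → ¬ TrueTwins G u v

TrueTwins-sym : (G : Graph) {u v : V G} → TrueTwins G u v → TrueTwins G v u
TrueTwins-sym G (u≢v , u⊆v , v⊆u) = u≢v ∘ sym , v⊆u , u⊆v

CircularPair-sym : (G : Graph) {u v : V G} → CircularPair G u v → CircularPair G v u
CircularPair-sym G ((span₁ , span₂) , ¬uv) = (span₂ , span₁) , ¬uv ∘ Adj-sym G

circularPartners-NSub : (G : Graph) {p x y : V G} →
  CircularPair G p x → CircularPair G p y → NSub G x y
circularPartners-NSub G {x = x} (_ , ¬px) ((_ , span) , _) = span x ¬px

circularPartner-unique : (G : Graph) → TwinFree G → {p x y : V G} →
  CircularPair G p x → CircularPair G p y → x ≡ y
circularPartner-unique G twinFree {x = x} {y} px py with x ≟ y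
... | yes x≡y = x≡y
... | no x≢y  = contradiction
  (x≢y , circularPartners-NSub G px py , circularPartners-NSub G py px) (twinFree x y)

CircularPair-twin : (G : Graph) {x y z : V G} → NSub G y z → NSub G z y →
  CircularPair G x y → CircularPair G x z
CircularPair-twin G y⊆z z⊆y ((span₁ , span₂) , ¬xy) =
  ((λ d ¬zd → span₁ d (¬zd ∘ y⊆z d)) , (λ d ¬xd → NSub-trans G (span₂ d ¬xd) y⊆z)) ,
  ¬xy ∘ Adj-sym G ∘ z⊆y _ ∘ Adj-sym G

circularlyPaired⇒¬Universal : (G : Graph) → CircularlyPaired G → ∀ u → ¬ Universal G u
circularlyPaired⇒¬Universal G paired u universal =
  let (v , _ , ¬uv) = paired u in ¬uv (universal v)

SameEdgeType : (G : Graph) → V G → V G → (H : Graph) → V H → V H → Set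
SameEdgeType G u v H x y =
    (InclusionEdge G u v ⇔ InclusionEdge H x y)
  × (OneOverlapEdge G u v ⇔ OneOverlapEdge H x y)
  × (TwoOverlapEdge G u v ⇔ TwoOverlapEdge H x y)

sameEdgeType : (G H : Graph) {u v : V G} {x y : V H} →
  Adj G u v ⇔ Adj H x y → NSub G u v ⇔ NSub H x y → NSub G v u ⇔ NSub H y x →
  SpanningPair G u v ⇔ SpanningPair H x y → SameEdgeType G u v H x y
sameEdgeType G H adj uv vu span =
  (adj ×-⇔ nested) , (overlapping ×-⇔ ¬-cong-⇔ span) , (overlapping ×-⇔ span)
  where
  nested      = uv ⊎-⇔ vu
  overlapping = adj ×-⇔ ¬-cong-⇔ nested

induced : (H : Graph) {k : ℕ} → (Fin k → V H) → Graph
induced H {k} ι = record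
  { n = k ; E = λ i j → E H (ι i) (ι j) ; loops = loops H ∘ ι ; symm = λ i j → symm H (ι i) (ι j) }

module Induced (H : Graph) {k : ℕ} (ι : Fin k → V H)
  (partner : ∀ i → ∃ λ j → CircularPair H (ι i) (ι j)) where

  H[ι] : Graph
  H[ι] = induced H ι

  NSub-restrict : ∀ {i j} → NSub H (ι i) (ι j) → NSub H[ι] i j
  NSub-restrict i⊆j = i⊆j ∘ ι

  -- If ι j ≁ d, then N[d] ⊆ N[ι m] for the partner m of j; so ι i ~ d would give i ~ m, hence j ~ m.
  NSub-extend : ∀ {i j} → NSub H[ι] i j → NSub H (ι i) (ι j)
  NSub-extend {i} {j} i⊆j d id with Adj? H (ι j) d
  ... | yes jd = jd
  ... | no ¬jd =
    let (m , (_ , span) , ¬jm) = partner j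
    in ⊥-elim (¬jm (i⊆j m (Adj-sym H (span d ¬jd (ι i) (Adj-sym H id)))))

  NSub⇔ : ∀ i j → NSub H (ι i) (ι j) ⇔ NSub H[ι] i j
  NSub⇔ i j = mk⇔ NSub-restrict NSub-extend

  SpanningPair⇔ : ∀ i j → SpanningPair H (ι i) (ι j) ⇔ SpanningPair H[ι] i j
  SpanningPair⇔ i j = mk⇔
    (map (λ span₁ d → NSub-restrict ∘ span₁ (ι d)) (λ span₂ d → NSub-restrict ∘ span₂ (ι d)))
    (map (extend i j) (extend j i))
    where
    extend : ∀ i j → (∀ d → ¬ Adj H[ι] j d → NSub H[ι] d i) → ∀ z → ¬ Adj H (ι j) z → NSub H z (ι i)
    extend i j span z ¬jz =
      let (m , (_ , span′) , ¬jm) = partner j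
      in NSub-trans H (span′ z ¬jz) (NSub-extend (span m ¬jm))

  SameEdgeType-induced : ∀ i j → SameEdgeType H (ι i) (ι j) H[ι] i j
  SameEdgeType-induced i j = sameEdgeType H H[ι] (⇔-id _) (NSub⇔ i j) (NSub⇔ j i) (SpanningPair⇔ i j)

  circularlyPaired : CircularlyPaired H[ι]
  circularlyPaired i =
    let (j , span , ¬ij) = partner i in j , Equivalence.to (SpanningPair⇔ i j) span , ¬ij

  module _ {G : Graph} (φ : InducedEmb G H) (image : ∀ u → ∃ λ i → ι i ≡ f φ u) where

    embedding : InducedEmb G H[ι]
    embedding = record
      { f     = proj₁ ∘ image
      ; inj   = λ u v i≡j → inj φ u v (trans (sym (proj₂ (image u))) (trans (cong ι i≡j) (proj₂ (image v))))
      ; adjEq = λ u v → trans (cong₂ (E H) (proj₂ (image u)) (proj₂ (image v))) (adjEq φ u v)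
      }

    preservesTypes : PreservesTypes G H φ → PreservesTypes G H[ι] embedding
    preservesTypes preserves u v uv =
      let (incl , one , two) = subst₂ (SameEdgeType G u v H) (sym (proj₂ (image u))) (sym (proj₂ (image v)))
                                      (preserves u v uv)
          (incl′ , one′ , two′) = SameEdgeType-induced (proj₁ (image u)) (proj₁ (image v))
      in ⇔.trans incl incl′ , ⇔.trans one one′ , ⇔.trans two two′

module _ {G H : Graph} (φ : InducedEmb G H) where

  Adj-preserve : ∀ {u v} → Adj G u v → Adj H (f φ u) (f φ v)
  Adj-preserve {u} {v} = trans (adjEq φ u v)

  Adj-reflect : ∀ {u v} → Adj H (f φ u) (f φ v) → Adj G u v
  Adj-reflect {u} {v} = trans (sym (adjEq φ u v))

  NSub-reflect : ∀ {u v} → NSub H (f φ u) (f φ v) → NSub G u v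
  NSub-reflect u⊆v x = Adj-reflect ∘ u⊆v (f φ x) ∘ Adj-preserve

  CircularPair-reflect : ∀ {u v} → CircularPair H (f φ u) (f φ v) → CircularPair G u v
  CircularPair-reflect ((span₁ , span₂) , ¬uv) =
    ((λ x ¬vx → NSub-reflect (span₁ (f φ x) (¬vx ∘ Adj-reflect))) ,
     (λ x ¬ux → NSub-reflect (span₂ (f φ x) (¬ux ∘ Adj-reflect)))) ,
    ¬uv ∘ Adj-preserve

  InImage? : ∀ w → Dec (InImage G H φ w)
  InImage? w = any? (λ u → f φ u ≟ w)

record Enumeration {n : ℕ} (P : Fin n → Set) : Set where
  field
    size         : ℕ
    at           : Fin size → Fin n
    at-injective : ∀ {i j} → at i ≡ at j → i ≡ j
    at-sound     : ∀ i → P (at i)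
    at-complete  : ∀ x → P x → ∃ λ i → at i ≡ x

enumerate-∉ : ∀ {n} (S : Subset n) → Σ (Enumeration (_∉ S)) λ e → Enumeration.size e + ∣ S ∣ ≡ n
enumerate-∉ [] = record
  { size = 0 ; at = λ () ; at-injective = λ {} ; at-sound = λ () ; at-complete = λ () } , refl
enumerate-∉ (inside ∷ S) = record
  { size         = size
  ; at           = suc ∘ at
  ; at-injective = at-injective ∘ suc-injective
  ; at-sound     = λ { i (there p) → at-sound i p }
  ; at-complete  = λ { zero x∉ → contradiction here x∉
                     ; (suc x) x∉ → map (λ i → i) (cong suc) (at-complete x (drop-not-there x∉)) }
  } , trans (+-suc size ∣ S ∣) (cong suc size+∣S∣≡n)
  where
  e,eq = enumerate-∉ S
  open Enumeration (proj₁ e,eq)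
  size+∣S∣≡n = proj₂ e,eq
enumerate-∉ (outside ∷ S) = record
  { size         = suc size
  ; at           = at′
  ; at-injective = at′-injective
  ; at-sound     = at′-sound
  ; at-complete  = λ { zero _ → zero , refl
                     ; (suc x) x∉ → map suc (cong suc) (at-complete x (drop-not-there x∉)) }
  } , cong suc (proj₂ e,eq)
  where
  e,eq = enumerate-∉ S
  open Enumeration (proj₁ e,eq)
  at′ : Fin (suc size) → Fin _
  at′ zero    = zero
  at′ (suc i) = suc (at i)
  at′-injective : ∀ {i j} → at′ i ≡ at′ j → i ≡ j
  at′-injective {zero}  {zero}  _  = refl
  at′-injective {suc i} {suc j} eq = cong suc (at-injective (suc-injective eq))
  at′-sound : ∀ i → at′ i ∉ outside ∷ S
  at′-sound (suc i) (there p) = at-sound i p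

disjoint-injections⇒+≤ : ∀ {a b m} {f : Fin a → Fin m} {g : Fin b → Fin m} →
  (∀ {i j} → f i ≡ f j → i ≡ j) → (∀ {i j} → g i ≡ g j → i ≡ j) → (∀ i j → f i ≢ g j) →
  a + b ≤ m
disjoint-injections⇒+≤ {a} {b} {f = f} {g} f-injective g-injective disjoint =
  injective⇒≤ {f = [ f , g ]′ ∘ splitAt a} injective
  where
  [f,g]-injective : ∀ x y → [ f , g ]′ x ≡ [ f , g ]′ y → x ≡ y
  [f,g]-injective (inj₁ i) (inj₁ j) eq = cong inj₁ (f-injective eq)
  [f,g]-injective (inj₁ i) (inj₂ j) eq = contradiction eq (disjoint i j)
  [f,g]-injective (inj₂ i) (inj₁ j) eq = contradiction (sym eq) (disjoint j i)
  [f,g]-injective (inj₂ i) (inj₂ j) eq = cong inj₂ (g-injective eq)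
  injective : ∀ {i j} → [ f , g ]′ (splitAt a i) ≡ [ f , g ]′ (splitAt a j) → i ≡ j
  injective {i} {j} eq = trans (sym (join-splitAt a b i))
    (trans (cong (join a b) ([f,g]-injective (splitAt a i) (splitAt a j) eq)) (join-splitAt a b j))

module CircularCompletion (G H : Graph) (φ : InducedEmb G H)
  (completion : IsCircularCompletion G H φ) where

  paired : CircularlyPaired H
  paired = proj₁ (proj₁ completion)

  no-removable-set : (D : Subset (n H)) {w : V H} → w ∈ D → (∀ u → f φ u ∉ D) →
    (∀ x → x ∉ D → ∃ λ y → y ∉ D × CircularPair H x y) → ⊥
  no-removable-set D {w} w∈D image∉D closed =
    ≤⇒≯ (proj₂ completion _ (embedding φ image) (circularlyPaired , preservesTypes φ image preserves))
        size<n
    where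
    open Enumeration (proj₁ (enumerate-∉ D))
    preserves = proj₂ (proj₁ completion)
    partner : ∀ i → ∃ λ j → CircularPair H (at i) (at j)
    partner i =
      let (y , y∉D , xy) = closed (at i) (at-sound i)
          (j , at-j≡y)   = at-complete y y∉D
      in j , subst (CircularPair H (at i)) (sym at-j≡y) xy
    image : ∀ u → ∃ λ i → at i ≡ f φ u
    image u = at-complete (f φ u) (image∉D u)
    open Induced H at partner
    1≤∣D∣ : 1 ≤ ∣ D ∣
    1≤∣D∣ = subst (_≤ ∣ D ∣) (∣⁅x⁆∣≡1 w)
      (p⊆q⇒∣p∣≤∣q∣ (λ x∈⁅w⁆ → subst (_∈ D) (sym (x∈⁅y⁆⇒x≡y w x∈⁅w⁆)) w∈D))
    size<n : size < n H
    size<n = subst (size <_) (proj₂ (enumerate-∉ D)) (m<m+n size 1≤∣D∣)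

  -- Partners of the removed twin w are redirected to t.
  twin-in-image : ∀ {w t} → TrueTwins H w t → InImage G H φ w
  twin-in-image {w} {t} (w≢t , w⊆t , t⊆w) with InImage? φ w
  ... | yes w∈image = w∈image
  ... | no w∉image  = ⊥-elim (no-removable-set ⁅ w ⁆ (x∈⁅x⁆ w) image∉D closed)
    where
    image∉D : ∀ u → f φ u ∉ ⁅ w ⁆
    image∉D u = w∉image ∘ (u ,_) ∘ x∈⁅y⁆⇒x≡y w
    closed : ∀ x → x ∉ ⁅ w ⁆ → ∃ λ y → y ∉ ⁅ w ⁆ × CircularPair H x y
    closed x _ with paired x
    ... | p , xp with p ≟ w
    ...   | yes refl = t , x≢y⇒x∉⁅y⁆ (w≢t ∘ sym) , CircularPair-twin H w⊆t t⊆w xp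
    ...   | no p≢w   = p , x≢y⇒x∉⁅y⁆ p≢w , xp

  twinFree : TwinFree G → TwinFree H
  twinFree twinFreeG u v twins@(u≢v , u⊆v , v⊆u)
    with twin-in-image twins | twin-in-image (TrueTwins-sym H twins)
  ... | u₀ , refl | v₀ , refl = twinFreeG u₀ v₀ (u≢v ∘ cong (f φ) , NSub-reflect φ u⊆v , NSub-reflect φ v⊆u)

  -- In a twin-free graph a and b are each other's only partners, so removing both keeps H closed.
  circularPair-meets-image : TwinFree H → ∀ a b → CircularPair H a b →
    InImage G H φ a ⊎ InImage G H φ b
  circularPair-meets-image twinFreeH a b ab with InImage? φ a | InImage? φ b
  ... | yes a∈image | _           = inj₁ a∈image
  ... | no _        | yes b∈image = inj₂ b∈image
  ... | no a∉image  | no b∉image  = ⊥-elim (no-removable-set D (∈D⁺ (inj₁ refl)) image∉D closed)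
    where
    D = ⁅ a ⁆ ∪ ⁅ b ⁆
    ∈D⁺ : ∀ {x} → x ≡ a ⊎ x ≡ b → x ∈ D
    ∈D⁺ (inj₁ refl) = x∈p∪q⁺ (inj₁ (x∈⁅x⁆ a))
    ∈D⁺ (inj₂ refl) = x∈p∪q⁺ (inj₂ (x∈⁅x⁆ b))
    ∈D⁻ : ∀ {x} → x ∈ D → x ≡ a ⊎ x ≡ b
    ∈D⁻ = Sum.map (x∈⁅y⁆⇒x≡y a) (x∈⁅y⁆⇒x≡y b) ∘ x∈p∪q⁻ ⁅ a ⁆ ⁅ b ⁆
    image∉D : ∀ u → f φ u ∉ D
    image∉D u = [ a∉image ∘ (u ,_) , b∉image ∘ (u ,_) ]′ ∘ ∈D⁻
    closed : ∀ x → x ∉ D → ∃ λ y → y ∉ D × CircularPair H x y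
    closed x x∉D with paired x
    ... | p , xp with p ≟ a | p ≟ b
    ...   | yes refl | _        = contradiction
      (∈D⁺ (inj₂ (circularPartner-unique H twinFreeH (CircularPair-sym H xp) ab))) x∉D
    ...   | no _     | yes refl = contradiction
      (∈D⁺ (inj₁ (circularPartner-unique H twinFreeH (CircularPair-sym H xp) (CircularPair-sym H ab)))) x∉D
    ...   | no p≢a   | no p≢b   = p , [ p≢a , p≢b ]′ ∘ ∈D⁻ , xp

  size-bound : TwinFree H → (S : Subset (n G)) → (∀ v → (v ∈ S) ⇔ InCircularPair G v) →
    2 * n G ≤ n H + ∣ S ∣
  size-bound twinFreeH S S⇔paired = begin
    2 * n G                ≡⟨ cong (n G +_) (+-identityʳ (n G)) ⟩
    n G + n G              ≡⟨ cong (n G +_) (sym size+∣S∣≡n) ⟩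
    n G + (size + ∣ S ∣)   ≡⟨ sym (+-assoc (n G) size ∣ S ∣) ⟩
    n G + size + ∣ S ∣     ≤⟨ +-monoˡ-≤ ∣ S ∣ (disjoint-injections⇒+≤ (inj φ _ _) partner-injective disjoint) ⟩
    n H + ∣ S ∣            ∎
    where
    open ≤-Reasoning
    open Enumeration (proj₁ (enumerate-∉ S))
    size+∣S∣≡n = proj₂ (enumerate-∉ S)
    partner : Fin size → V H
    partner i = proj₁ (paired (f φ (at i)))
    partner-pair : ∀ i → CircularPair H (partner i) (f φ (at i))
    partner-pair i = CircularPair-sym H (proj₂ (paired (f φ (at i))))
    partner-injective : ∀ {i j} → partner i ≡ partner j → i ≡ j
    partner-injective {i} {j} eq = at-injective (inj φ _ _ (circularPartner-unique H twinFreeH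
      (partner-pair i) (subst (λ z → CircularPair H z (f φ (at j))) (sym eq) (partner-pair j))))
    disjoint : ∀ u i → f φ u ≢ partner i
    disjoint u i eq = at-sound i (Equivalence.from (S⇔paired (at i))
      (u , CircularPair-reflect φ (CircularPair-sym H
        (subst (λ z → CircularPair H z (f φ (at i))) (sym eq) (partner-pair i)))))

lemma12 : (G G' : Graph) (φ : InducedEmb G G') →
    NoUnivNoTwins G →
    IsCircularCompletion G G' φ →
      NoUnivNoTwins G'
    × (∀ a b → CircularPair G' a b → InImage G G' φ a ⊎ InImage G G' φ b)
    × (∀ (S : Subset (n G)) → (∀ v → (v ∈ S) ⇔ InCircularPair G v) →
         2 * n G ≤ n G' + ∣ S ∣)
lemma12 G G' φ (_ , twinFreeG) completion =
    (circularlyPaired⇒¬Universal G' paired , twinFreeG')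
  , circularPair-meets-image twinFreeG'
  , size-bound twinFreeG'
  where
  open CircularCompletion G G' φ completion
  twinFreeG' = twinFree twinFreeG
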